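{- Let $k\ge1$, let $\alpha_1,\ldots,\alpha_k$ be pairwise distinct non-zero integers, let $\mu\ge0$ be an integer and $n$ a positive integer. Then $$|B_{n,\mu,0}(1)|\le (kn)!\binom{kn+\mu}{\mu}\prod_{i=1}^k(|\alpha_i|+1)^n,$$ for each $j=1,\ldots,k$ $$|B_{n,\mu,j}(1)|\le (kn+\mu)!\,(kn+\mu)\,|\alpha_j|^{\mu-1}\prod_{i=1}^k(|\alpha_i|+|\alpha_j|)^n,$$ and for each prime $p$ and each $j=1,\ldots,k$ $$|S_{n,\mu,j}(1)|_p\le |(kn+\mu)!\,n!|_p\left(\max_{1\le i\le k}|\alpha_i|_p\right)^{(k+1)n}.$$
   Context: $|\cdot|_p$ is the $p$-adic absolute value with $|p|_p=p^{ -1}$. For $0\le i\le kn$ let $$\sigma_i=(-1)^i\sum_{\substack{i_1+\cdots+i_k=i\\0\le i_j\le n}}\binom{n}{i_1}\cdots\binom{n}{i_k}\alpha_1^{n-i_1}\cdots\alpha_k^{n-i_k}.$$ Define $B_{n,\mu,0}(1)=\sum_{i=0}^{kn}\sigma_i\frac{(kn+\mu)!}{(i+\mu)!}$, $B_{n,\mu,j}(1)=(kn+\mu)!\sum_{N=0}^{kn+\mu-1}\sum_{h=0}^{\min\{kn,N\}}\sigma_{kn-h}\frac{(N-h)!}{(kn+\mu-h)!}\alpha_j^{N-h}$ for $1\le j\le k$, and $S_{n,\mu,j}(1)\in\mathbb{Q}_p$ as the $p$-adically convergent series $$S_{n,\mu,j}(1)=(kn+\mu)!\,n!\sum_{h=0}^\infty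 h!\binom{n+h}{h}\alpha_j^{n+h+\mu}\sum_{i=0}^{kn}\sigma_i\binom{i+\mu+n+h}{i+\mu}\alpha_j^i .$$ -}

module Defs where

open import Data.Nat as ℕ using (ℕ; zero; suc; _∸_; _!; _≡ᵇ_)
open import Data.Nat.Combinatorics using (_C_)
open import Data.Integer as ℤ using (ℤ; +_; -1ℤ; 0ℤ; 1ℤ)
open import Data.Rational as ℚ using (ℚ; 0ℚ)
open import Data.Fin using (Fin)
open import Data.Vec using (Vec; []; _∷_; lookup)
open import Data.List using (List; []; _∷_; map; concatMap; upTo; allFin; foldr)
open import Data.Bool using (if_then_else_)
open import Data.Nat.Properties using (_!≢0)
open import Data.Integer.Divisibility using (_∣_)
open import Data.Product using (Σ)

sumℤ : List ℤ → ℤ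
sumℤ = foldr ℤ._+_ 0ℤ

prodℤ : List ℤ → ℤ
prodℤ = foldr ℤ._*_ 1ℤ

sumℚ : List ℚ → ℚ
sumℚ = foldr ℚ._+_ 0ℚ

prodℕ : List ℕ → ℕ
prodℕ = foldr ℕ._*_ 1

sumV : ∀ {k} → Vec ℕ k → ℕ
sumV [] = 0
sumV (x ∷ v) = x ℕ.+ sumV v

tuples : (k m : ℕ) → List (Vec ℕ k)
tuples zero m = [] ∷ []
tuples (suc k) m = concatMap (λ a → map (a ∷_) (tuples k m)) (upTo (suc m))

σ : (k n : ℕ) (α : Fin k → ℤ) (i : ℕ) → ℤ
σ k n α i = (-1ℤ ℤ.^ i) ℤ.*
  sumℤ (map (λ t → if sumV t ≡ᵇ i
                   then prodℤ (map (λ j → (+ (n C lookup t j)) ℤ.* (α j ℤ.^ (n ∸ lookup t j))) (allFin k))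
                   else 0ℤ)
            (tuples k n))

-- B_{n,μ,0}(1) = Σ_{i=0}^{kn} σ_i (kn+μ)!/(i+μ)!
B0 : (k n μ : ℕ) (α : Fin k → ℤ) → ℚ
B0 k n μ α = sumℚ (map (λ i → ℚ._/_ (σ k n α i ℤ.* (+ ((k ℕ.* n ℕ.+ μ) !))) ((i ℕ.+ μ) !) {{(i ℕ.+ μ) !≢0}})
                        (upTo (suc (k ℕ.* n))))

-- B_{n,μ,j}(1) = (kn+μ)! Σ_{N=0}^{kn+μ-1} Σ_{h=0}^{min(kn,N)} σ_{kn-h} (N-h)!/(kn+μ-h)! α_j^{N-h}
Bj : (k n μ : ℕ) (α : Fin k → ℤ) (j : Fin k) → ℚ
Bj k n μ α j =
  ℚ._*_ (ℚ._/_ (+ ((k ℕ.* n ℕ.+ μ) !)) 1)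
   (sumℚ (map (λ N → sumℚ (map (λ h →
        ℚ._/_ (σ k n α (k ℕ.* n ∸ h) ℤ.* (+ ((N ∸ h) !)) ℤ.* (α j ℤ.^ (N ∸ h)))
              ((k ℕ.* n ℕ.+ μ ∸ h) !) {{(k ℕ.* n ℕ.+ μ ∸ h) !≢0}})
        (upTo (suc (k ℕ.* n ℕ.⊓ N)))))
     (upTo (k ℕ.* n ℕ.+ μ))))

-- h-th term of the p-adic series S_{n,μ,j}(1) (an integer):
-- (kn+μ)! n! h! C(n+h,h) α_j^{n+h+μ} Σ_{i=0}^{kn} σ_i C(i+μ+n+h, i+μ) α_j^i
Sterm : (k n μ : ℕ) (α : Fin k → ℤ) (j : Fin k) (h : ℕ) → ℤ
Sterm k n μ α j h =
  (+ ((k ℕ.* n ℕ.+ μ) ! ℕ.* n ! ℕ.* h ! ℕ.* ((n ℕ.+ h) C h))) ℤ.* (α j ℤ.^ (n ℕ.+ h ℕ.+ μ)) ℤ.*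
  sumℤ (map (λ i → σ k n α i ℤ.* (+ ((i ℕ.+ μ ℕ.+ n ℕ.+ h) C (i ℕ.+ μ))) ℤ.* (α j ℤ.^ i))
            (upTo (suc (k ℕ.* n))))

Spartial : (k n μ : ℕ) (α : Fin k → ℤ) (j : Fin k) (N : ℕ) → ℤ
Spartial k n μ α j N = sumℤ (map (Sterm k n μ α j) (upTo N))

-- |S|_p ≤ |y_1|_p ⊔ … ⊔ |y_k|_p (all y_i ≠ 0), for S the p-adic limit of the integer
-- partial sums Spartial N: for every e, if p^e divides every y_i then p^e divides
-- all sufficiently late partial sums (equivalently, p^e divides the limit S).
padicBound : (p : ℕ) (Spart : ℕ → ℤ) (k : ℕ) (y : Fin k → ℤ) → Set
padicBound p Spart k y =
  ∀ (e : ℕ) → (∀ i → (+ (p ℕ.^ e)) ∣ y i) →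
    Σ ℕ λ N₀ → ∀ N → N₀ ℕ.≤ N → (+ (p ℕ.^ e)) ∣ Spart N

{-# OPTIONS --safe #-}
module Submission where

-- Up to sign, σᵢ is the coefficient of aⁱ in ∏ⱼ (αⱼ + a)ⁿ, so the binomial theorem and the
-- triangle inequality give Σᵢ ∣σᵢ∣ aⁱ ≤ ∏ⱼ (∣αⱼ∣ + a)ⁿ for every a ≥ 0.  The bound for B₀ is
-- this with a = 1, after (kn+μ)!/(i+μ)! ≤ (kn)! C(kn+μ, μ).  For Bⱼ take a = ∣αⱼ∣: dropping
-- (N−h)!/(kn+μ−h)! ≤ 1 and using N − h < kn − h + μ, each inner sum over h times ∣αⱼ∣ is at most
-- ∣αⱼ∣^μ ∏ᵢ (∣αᵢ∣ + ∣αⱼ∣)ⁿ, and there are kn + μ values of N.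
-- For the p-adic bound let pᵐ be the largest power of p dividing every αᵢ.  Since σᵢ is
-- homogeneous of degree kn − i in the α's, every term of the series is divisible by
-- (kn+μ)! n! p^(m(k+1)n); and a power of p dividing every (kn+μ)! n! αᵢ^((k+1)n) divides this
-- number too (look at an αᵢ of minimal p-adic valuation), hence every partial sum of the series.

open import Data.Bool.Base using (true; false; T; if_then_else_)
open import Data.Bool.Properties using (if-float)
open import Data.Fin.Base as Fin using (Fin; toℕ)
open import Data.List.Base using (List; []; _∷_; _++_; map; applyUpTo; upTo; concatMap; allFin)
open import Data.List.Properties
  using (map-cong; map-∘; map-++; map-tabulate; applyUpTo-∷ʳ; map-upTo)
open import Data.Nat.Base
open import Data.Nat.Properties
import Data.Nat as ℕ
open import Data.Nat.Combinatorics using (_C_; k![n∸k]!∣n!)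
open import Data.Nat.Combinatorics.Specification using (nCk≡n!/k![n-k]!)
open import Data.Nat.DivMod using (m/n*n≡m)
open import Data.Nat.Divisibility
  using (_∣_; _∤_; divides; _∣?_; ∣-refl; ∣m⇒∣m*n; m*n∣⇒m∣; *-monoʳ-∣; *-cancelˡ-∣; ∣1⇒≡1; 1∣_;
         m≤n⇒m!∣n!; ∣⇒≤; quotient≢0; quotient-<)
open import Data.Nat.Induction using (<-rec)
open import Data.Nat.ListAction using (sum; product)
open import Data.Nat.ListAction.Properties using (sum-++)
open import Data.Nat.Primality using (Prime; euclidsLemma; prime⇒nonZero; prime⇒nonTrivial)
open import Data.Nat.Tactic.RingSolver using (solve-∀)
open import Data.Integer as ℤ using (ℤ; -1ℤ)
import Data.Integer.Properties as ℤₚ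
open import Data.Integer.Divisibility.Signed as ℤ∣ using (divides) renaming (_∣_ to _∣ₛ_)
open import Data.Rational as ℚ using (ℚ; toℚᵘ)
import Data.Rational.Properties as ℚₚ
open import Data.Rational.Unnormalised.Base as ℚᵘ using (mkℚᵘ; *≤*; *≡*)
import Data.Rational.Unnormalised.Properties as ℚᵘₚ
open import Data.Product.Base using (∃-syntax; _×_; _,_; proj₁; proj₂)
open import Data.Sum.Base using (inj₁; inj₂)
open import Data.Unit.Base using (tt)
open import Data.Vec.Base using (Vec; []; _∷_; lookup)
open import Function.Base using (_∘_)
open import Function.Definitions using (Injective)
open import Relation.Binary.PropositionalEquality
open import Relation.Nullary.Decidable.Core using (yes; no)
open import Relation.Nullary.Negation.Core using (contradiction)
open import Algebra.Properties.CommutativeSemigroup +-commutativeSemigroup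
  using () renaming (interchange to +-interchange)
open import Algebra.Properties.CommutativeSemigroup *-commutativeSemigroup
  using () renaming (interchange to *-interchange; xy∙z≈xz∙y to *-right-comm)
import Algebra.Properties.CommutativeSemiring.Binomial +-*-commutativeSemiring as Binomial
open import Algebra.Properties.Semiring.Exp +-*-semiring using () renaming (_^_ to _^ᴿ_)
open import Algebra.Definitions.RawMonoid +-0-rawMonoid using () renaming (_×_ to _×ᴹ_; sum to sumᶠ)
open import Defs
  using (prodℕ; sumV; tuples; σ; sumℤ; prodℤ; sumℚ; B0; Bj; Sterm; Spartial; padicBound)

∑< : ℕ → (ℕ → ℕ) → ℕ
∑< n f = sum (applyUpTo f n)

∑<-mono : ∀ n {f g : ℕ → ℕ} → (∀ i → i < n → f i ≤ g i) → ∑< n f ≤ ∑< n g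
∑<-mono zero    f≤g = z≤n
∑<-mono (suc n) f≤g = +-mono-≤ (f≤g 0 z<s) (∑<-mono n (λ i i<n → f≤g (suc i) (s<s i<n)))

∑<-cong : ∀ n {f g : ℕ → ℕ} → (∀ i → f i ≡ g i) → ∑< n f ≡ ∑< n g
∑<-cong zero    f≗g = refl
∑<-cong (suc n) f≗g = cong₂ _+_ (f≗g 0) (∑<-cong n (f≗g ∘ suc))

∑<-monoˡ : ∀ (f : ℕ → ℕ) {m n} → m ≤ n → ∑< m f ≤ ∑< n f
∑<-monoˡ f z≤n       = z≤n
∑<-monoˡ f (s≤s m≤n) = +-monoʳ-≤ (f 0) (∑<-monoˡ (f ∘ suc) m≤n)

∑<-snoc : ∀ n (f : ℕ → ℕ) → ∑< (suc n) f ≡ ∑< n f + f n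
∑<-snoc n f = begin
  sum (applyUpTo f (suc n))       ≡⟨ cong sum (applyUpTo-∷ʳ f n) ⟨
  sum (applyUpTo f n ++ f n ∷ [])  ≡⟨ sum-++ (applyUpTo f n) (f n ∷ []) ⟩
  ∑< n f + (f n + 0)               ≡⟨ cong (∑< n f +_) (+-identityʳ (f n)) ⟩
  ∑< n f + f n                     ∎
  where open ≡-Reasoning

∑<-reverse : ∀ m (f : ℕ → ℕ) → ∑< (suc m) (λ h → f (m ∸ h)) ≡ ∑< (suc m) f
∑<-reverse zero    f = refl
∑<-reverse (suc m) f = begin
  f (suc m) + ∑< (suc m) (λ h → f (m ∸ h))  ≡⟨ cong (f (suc m) +_) (∑<-reverse m f) ⟩
  f (suc m) + ∑< (suc m) f                   ≡⟨ +-comm (f (suc m)) _ ⟩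
  ∑< (suc m) f + f (suc m)                   ≡⟨ ∑<-snoc (suc m) f ⟨
  ∑< (suc (suc m)) f                         ∎
  where open ≡-Reasoning

∑<-const : ∀ n c → ∑< n (λ _ → c) ≡ n * c
∑<-const zero    c = refl
∑<-const (suc n) c = cong (c +_) (∑<-const n c)

∑<-distribʳ : ∀ n (f : ℕ → ℕ) c → ∑< n f * c ≡ ∑< n (λ i → f i * c)
∑<-distribʳ zero    f c = refl
∑<-distribʳ (suc n) f c =
  trans (*-distribʳ-+ c (f 0) _) (cong (f 0 * c +_) (∑<-distribʳ n (f ∘ suc) c))

∑<-distrib-+ : ∀ n (f g : ℕ → ℕ) → ∑< n (λ i → f i + g i) ≡ ∑< n f + ∑< n g
∑<-distrib-+ zero    f g = refl
∑<-distrib-+ (suc n) f g = trans (cong (f 0 + g 0 +_) (∑<-distrib-+ n (f ∘ suc) (g ∘ suc)))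
                         (+-interchange (f 0) (g 0) _ _)

sum-map-mono : ∀ {A : Set} (xs : List A) {f g : A → ℕ} → (∀ x → f x ≤ g x) →
               sum (map f xs) ≤ sum (map g xs)
sum-map-mono []       f≤g = z≤n
sum-map-mono (x ∷ xs) f≤g = +-mono-≤ (f≤g x) (sum-map-mono xs f≤g)

sum-map-cong : ∀ {A : Set} (xs : List A) {f g : A → ℕ} → (∀ x → f x ≡ g x) →
               sum (map f xs) ≡ sum (map g xs)
sum-map-cong xs f≗g = cong sum (map-cong f≗g xs)

sum-map-distribˡ : ∀ {A : Set} (xs : List A) (f : A → ℕ) c →
                   c * sum (map f xs) ≡ sum (map (λ x → c * f x) xs)
sum-map-distribˡ []       f c = *-zeroʳ c
sum-map-distribˡ (x ∷ xs) f c =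
  trans (*-distribˡ-+ c (f x) _) (cong (c * f x +_) (sum-map-distribˡ xs f c))

sum-map-distribʳ : ∀ {A : Set} (xs : List A) (f : A → ℕ) c →
                   sum (map f xs) * c ≡ sum (map (λ x → f x * c) xs)
sum-map-distribʳ []       f c = refl
sum-map-distribʳ (x ∷ xs) f c =
  trans (*-distribʳ-+ c (f x) _) (cong (f x * c +_) (sum-map-distribʳ xs f c))

sum-map-concatMap : ∀ {A B : Set} (xs : List A) (F : A → List B) (g : B → ℕ) →
  sum (map g (concatMap F xs)) ≡ sum (map (λ a → sum (map g (F a))) xs)
sum-map-concatMap []       F g = refl
sum-map-concatMap (x ∷ xs) F g = begin
  sum (map g (F x ++ concatMap F xs))             ≡⟨ cong sum (map-++ g (F x) _) ⟩
  sum (map g (F x) ++ map g (concatMap F xs))     ≡⟨ sum-++ (map g (F x)) _ ⟩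
  sum (map g (F x)) + sum (map g (concatMap F xs))
                                                  ≡⟨ cong (sum (map g (F x)) +_) (sum-map-concatMap xs F g) ⟩
  sum (map (λ a → sum (map g (F a))) (x ∷ xs))    ∎
  where open ≡-Reasoning

∑<-sum-comm : ∀ {A : Set} n (xs : List A) (G : ℕ → A → ℕ) →
  ∑< n (λ i → sum (map (G i) xs)) ≡ sum (map (λ x → ∑< n (λ i → G i x)) xs)
∑<-sum-comm n []       G = trans (∑<-const n 0) (*-zeroʳ n)
∑<-sum-comm n (x ∷ xs) G = trans (∑<-distrib-+ n (λ i → G i x) (λ i → sum (map (G i) xs)))
                                 (cong (∑< n (λ i → G i x) +_) (∑<-sum-comm n xs G))

∑<-indicator : ∀ n s (f : ℕ → ℕ) → ∑< n (λ i → if s ≡ᵇ i then f i else 0) ≤ f s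
∑<-indicator zero    s       f = z≤n
∑<-indicator (suc n) zero    f = ≤-reflexive (begin
  f 0 + ∑< n (λ _ → 0)  ≡⟨ cong (f 0 +_) (trans (∑<-const n 0) (*-zeroʳ n)) ⟩
  f 0 + 0               ≡⟨ +-identityʳ (f 0) ⟩
  f 0                   ∎)
  where open ≡-Reasoning
∑<-indicator (suc n) (suc s) f = ∑<-indicator n s (f ∘ suc)

-- The size of the σᵢ

map-allFin-suc : ∀ {A : Set} k (f : Fin (suc k) → A) →
                 map f (allFin (suc k)) ≡ f Fin.zero ∷ map (f ∘ Fin.suc) (allFin k)
map-allFin-suc k f =
  cong (f Fin.zero ∷_) (trans (map-tabulate Fin.suc f) (sym (map-tabulate (λ j → j) (f ∘ Fin.suc))))

sum-tuples-product : ∀ k n (f : Fin k → ℕ → ℕ) →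
  sum (map (λ t → product (map (λ j → f j (lookup t j)) (allFin k))) (tuples k n))
    ≡ product (map (λ j → ∑< (suc n) (f j)) (allFin k))
sum-tuples-product zero    n f = refl
sum-tuples-product (suc k) n f = begin
  sum (map (prodAt f) (concatMap (λ c → map (c ∷_) (tuples k n)) (upTo (suc n))))
    ≡⟨ sum-map-concatMap (upTo (suc n)) (λ c → map (c ∷_) (tuples k n)) (prodAt f) ⟩
  sum (map (λ c → sum (map (prodAt f) (map (c ∷_) (tuples k n)))) (upTo (suc n)))
    ≡⟨ sum-map-cong (upTo (suc n)) first-factor ⟩
  sum (map (λ c → f Fin.zero c * R) (upTo (suc n)))
    ≡⟨ cong sum (map-upTo (λ c → f Fin.zero c * R) (suc n)) ⟩
  ∑< (suc n) (λ c → f Fin.zero c * R)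
    ≡⟨ ∑<-distribʳ (suc n) (f Fin.zero) R ⟨
  ∑< (suc n) (f Fin.zero) * R
    ≡⟨ cong product (map-allFin-suc k (λ j → ∑< (suc n) (f j))) ⟨
  product (map (λ j → ∑< (suc n) (f j)) (allFin (suc k))) ∎
  where
  open ≡-Reasoning
  prodAt : ∀ {m} → (Fin m → ℕ → ℕ) → Vec ℕ m → ℕ
  prodAt {m} g t = product (map (λ j → g j (lookup t j)) (allFin m))
  R = product (map (λ j → ∑< (suc n) (f (Fin.suc j))) (allFin k))
  first-factor : ∀ c → sum (map (prodAt f) (map (c ∷_) (tuples k n))) ≡ f Fin.zero c * R
  first-factor c = begin
    sum (map (prodAt f) (map (c ∷_) (tuples k n)))
      ≡⟨ cong sum (map-∘ (tuples k n)) ⟨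
    sum (map (λ t → prodAt f (c ∷ t)) (tuples k n))
      ≡⟨ sum-map-cong (tuples k n) (λ t → cong product (map-allFin-suc k (λ j → f j (lookup (c ∷ t) j)))) ⟩
    sum (map (λ t → f Fin.zero c * prodAt (f ∘ Fin.suc) t) (tuples k n))
      ≡⟨ sum-map-distribˡ (tuples k n) (prodAt (f ∘ Fin.suc)) (f Fin.zero c) ⟨
    f Fin.zero c * sum (map (prodAt (f ∘ Fin.suc)) (tuples k n))
      ≡⟨ cong (f Fin.zero c *_) (sum-tuples-product k n (f ∘ Fin.suc)) ⟩
    f Fin.zero c * R ∎

×ᴹ≡* : ∀ n x → n ×ᴹ x ≡ n * x
×ᴹ≡* zero    x = refl
×ᴹ≡* (suc n) x = cong (x +_) (×ᴹ≡* n x)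

^ᴿ≡^ : ∀ x n → x ^ᴿ n ≡ x ^ n
^ᴿ≡^ x zero    = refl
^ᴿ≡^ x (suc n) = cong (x *_) (^ᴿ≡^ x n)

sumᶠ≡∑< : ∀ n (f : ℕ → ℕ) → sumᶠ {n} (f ∘ toℕ) ≡ ∑< n f
sumᶠ≡∑< zero    f = refl
sumᶠ≡∑< (suc n) f = cong (f 0 +_) (sumᶠ≡∑< n (f ∘ suc))

binomial-theorem : ∀ n x a → ∑< (suc n) (λ c → (n C c) * x ^ (n ∸ c) * a ^ c) ≡ (x + a) ^ n
binomial-theorem n x a = begin
  ∑< (suc n) (λ c → (n C c) * x ^ (n ∸ c) * a ^ c)
    ≡⟨ ∑<-cong (suc n) term ⟨
  ∑< (suc n) (λ c → (n C c) ×ᴹ (a ^ᴿ c * x ^ᴿ (n ∸ c)))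
    ≡⟨ sumᶠ≡∑< (suc n) (λ c → (n C c) ×ᴹ (a ^ᴿ c * x ^ᴿ (n ∸ c))) ⟨
  Binomial.binomialExpansion a x n
    ≡⟨ Binomial.theorem n a x ⟨
  (a + x) ^ᴿ n
    ≡⟨ ^ᴿ≡^ (a + x) n ⟩
  (a + x) ^ n
    ≡⟨ cong (_^ n) (+-comm a x) ⟩
  (x + a) ^ n ∎
  where
  open ≡-Reasoning
  term : ∀ c → (n C c) ×ᴹ (a ^ᴿ c * x ^ᴿ (n ∸ c)) ≡ (n C c) * x ^ (n ∸ c) * a ^ c
  term c = begin
    (n C c) ×ᴹ (a ^ᴿ c * x ^ᴿ (n ∸ c))  ≡⟨ ×ᴹ≡* (n C c) _ ⟩
    (n C c) * (a ^ᴿ c * x ^ᴿ (n ∸ c))   ≡⟨ cong ((n C c) *_) (cong₂ _*_ (^ᴿ≡^ a c) (^ᴿ≡^ x (n ∸ c))) ⟩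
    (n C c) * (a ^ c * x ^ (n ∸ c))     ≡⟨ cong ((n C c) *_) (*-comm (a ^ c) _) ⟩
    (n C c) * (x ^ (n ∸ c) * a ^ c)     ≡⟨ *-assoc (n C c) _ _ ⟨
    (n C c) * x ^ (n ∸ c) * a ^ c       ∎

product-*-^-sumV : ∀ k (t : Vec ℕ k) (g : Fin k → ℕ → ℕ) a →
  product (map (λ j → g j (lookup t j)) (allFin k)) * a ^ sumV t
    ≡ product (map (λ j → g j (lookup t j) * a ^ lookup t j) (allFin k))
product-*-^-sumV zero    []      g a = refl
product-*-^-sumV (suc k) (c ∷ t) g a = begin
  product (map (λ j → g j (lookup (c ∷ t) j)) (allFin (suc k))) * a ^ (c + sumV t)
    ≡⟨ cong₂ _*_ (cong product (map-allFin-suc k (λ j → g j (lookup (c ∷ t) j))))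
                 (^-distribˡ-+-* a c (sumV t)) ⟩
  (g Fin.zero c * P) * (a ^ c * a ^ sumV t)
    ≡⟨ *-interchange (g Fin.zero c) P (a ^ c) (a ^ sumV t) ⟩
  (g Fin.zero c * a ^ c) * (P * a ^ sumV t)
    ≡⟨ cong ((g Fin.zero c * a ^ c) *_) (product-*-^-sumV k t (g ∘ Fin.suc) a) ⟩
  (g Fin.zero c * a ^ c)
    * product (map (λ j → g (Fin.suc j) (lookup t j) * a ^ lookup t j) (allFin k))
    ≡⟨ cong product (map-allFin-suc k (λ j → g j (lookup (c ∷ t) j) * a ^ lookup (c ∷ t) j)) ⟨
  product (map (λ j → g j (lookup (c ∷ t) j) * a ^ lookup (c ∷ t) j) (allFin (suc k))) ∎
  where
  open ≡-Reasoning
  P = product (map (λ j → g (Fin.suc j) (lookup t j)) (allFin k))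

tupleWeight : (k n : ℕ) (x : Fin k → ℕ) → Vec ℕ k → ℕ
tupleWeight k n x t = product (map (λ j → (n C lookup t j) * x j ^ (n ∸ lookup t j)) (allFin k))

-- The coefficient of aⁱ in ∏ⱼ (x j + a)ⁿ.
σ⁺ : (k n : ℕ) (x : Fin k → ℕ) (i : ℕ) → ℕ
σ⁺ k n x i = sum (map (λ t → if sumV t ≡ᵇ i then tupleWeight k n x t else 0) (tuples k n))

∑σ⁺*^≤∏[x+a]^n : ∀ k n (x : Fin k → ℕ) a m →
  ∑< m (λ i → σ⁺ k n x i * a ^ i) ≤ product (map (λ j → (x j + a) ^ n) (allFin k))
∑σ⁺*^≤∏[x+a]^n k n x a m = begin
  ∑< m (λ i → σ⁺ k n x i * a ^ i)
    ≡⟨ ∑<-cong m (λ i → trans (sum-map-distribʳ ts _ (a ^ i))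
                              (sum-map-cong ts (λ t → if-float (_* a ^ i) (sumV t ≡ᵇ i)))) ⟩
  ∑< m (λ i → sum (map (λ t → if sumV t ≡ᵇ i then tupleWeight k n x t * a ^ i else 0) ts))
    ≡⟨ ∑<-sum-comm m ts (λ i t → if sumV t ≡ᵇ i then tupleWeight k n x t * a ^ i else 0) ⟩
  sum (map (λ t → ∑< m (λ i → if sumV t ≡ᵇ i then tupleWeight k n x t * a ^ i else 0)) ts)
    ≤⟨ sum-map-mono ts (λ t → ∑<-indicator m (sumV t) (λ i → tupleWeight k n x t * a ^ i)) ⟩
  sum (map (λ t → tupleWeight k n x t * a ^ sumV t) ts)
    ≡⟨ sum-map-cong ts (λ t → product-*-^-sumV k t (λ j c → (n C c) * x j ^ (n ∸ c)) a) ⟩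
  sum (map (λ t → product (map (λ j → f j (lookup t j)) (allFin k))) ts)
    ≡⟨ sum-tuples-product k n f ⟩
  product (map (λ j → ∑< (suc n) (f j)) (allFin k))
    ≡⟨ cong product (map-cong (λ j → binomial-theorem n (x j) a) (allFin k)) ⟩
  product (map (λ j → (x j + a) ^ n) (allFin k)) ∎
  where
  open ≤-Reasoning
  ts = tuples k n
  f : Fin k → ℕ → ℕ
  f j c = (n C c) * x j ^ (n ∸ c) * a ^ c

∣sumℤ∣≤sum∣∣ : ∀ xs → ℤ.∣ sumℤ xs ∣ ≤ sum (map ℤ.∣_∣ xs)
∣sumℤ∣≤sum∣∣ []       = z≤n
∣sumℤ∣≤sum∣∣ (x ∷ xs) =
  ≤-trans (ℤₚ.∣i+j∣≤∣i∣+∣j∣ x (sumℤ xs)) (+-monoʳ-≤ ℤ.∣ x ∣ (∣sumℤ∣≤sum∣∣ xs))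

∣prodℤ∣≡product∣∣ : ∀ xs → ℤ.∣ prodℤ xs ∣ ≡ product (map ℤ.∣_∣ xs)
∣prodℤ∣≡product∣∣ []       = refl
∣prodℤ∣≡product∣∣ (x ∷ xs) =
  trans (ℤₚ.abs-* x (prodℤ xs)) (cong (ℤ.∣ x ∣ *_) (∣prodℤ∣≡product∣∣ xs))

∣^∣ : ∀ x e → ℤ.∣ x ℤ.^ e ∣ ≡ ℤ.∣ x ∣ ^ e
∣^∣ x zero    = refl
∣^∣ x (suc e) = trans (ℤₚ.abs-* x (x ℤ.^ e)) (cong (ℤ.∣ x ∣ *_) (∣^∣ x e))

tupleFactor : ∀ {k} (n : ℕ) (α : Fin k → ℤ) → Vec ℕ k → Fin k → ℤ
tupleFactor n α t j = ℤ.+ (n C lookup t j) ℤ.* α j ℤ.^ (n ∸ lookup t j)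

-- σ k n α i unfolds to (-1)ⁱ times the sum of tupleTerm k n α t over the tuples t with sumV t ≡ i.
tupleTerm : (k n : ℕ) (α : Fin k → ℤ) → Vec ℕ k → ℤ
tupleTerm k n α t = prodℤ (map (tupleFactor n α t) (allFin k))

∣tupleTerm∣≡tupleWeight : ∀ k n (α : Fin k → ℤ) t →
                          ℤ.∣ tupleTerm k n α t ∣ ≡ tupleWeight k n (ℤ.∣_∣ ∘ α) t
∣tupleTerm∣≡tupleWeight k n α t = begin
  ℤ.∣ tupleTerm k n α t ∣                          ≡⟨ ∣prodℤ∣≡product∣∣ (map factor (allFin k)) ⟩
  product (map ℤ.∣_∣ (map factor (allFin k)))      ≡⟨ cong product (map-∘ (allFin k)) ⟨
  product (map (ℤ.∣_∣ ∘ factor) (allFin k))        ≡⟨ cong product (map-cong ∣factor∣ (allFin k)) ⟩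
  tupleWeight k n (ℤ.∣_∣ ∘ α) t                    ∎
  where
  open ≡-Reasoning
  factor = tupleFactor n α t
  ∣factor∣ : ∀ j → ℤ.∣ factor j ∣ ≡ (n C lookup t j) * ℤ.∣ α j ∣ ^ (n ∸ lookup t j)
  ∣factor∣ j = trans (ℤₚ.abs-* (ℤ.+ (n C lookup t j)) _)
                     (cong ((n C lookup t j) *_) (∣^∣ (α j) (n ∸ lookup t j)))

∣σ∣≤σ⁺ : ∀ k n (α : Fin k → ℤ) i → ℤ.∣ σ k n α i ∣ ≤ σ⁺ k n (ℤ.∣_∣ ∘ α) i
∣σ∣≤σ⁺ k n α i = begin
  ℤ.∣ σ k n α i ∣
    ≡⟨ ℤₚ.abs-* (-1ℤ ℤ.^ i) _ ⟩
  ℤ.∣ -1ℤ ℤ.^ i ∣ * ℤ.∣ sumℤ (map E ts) ∣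
    ≡⟨ cong (_* ℤ.∣ sumℤ (map E ts) ∣) (trans (∣^∣ -1ℤ i) (^-zeroˡ i)) ⟩
  1 * ℤ.∣ sumℤ (map E ts) ∣
    ≡⟨ *-identityˡ _ ⟩
  ℤ.∣ sumℤ (map E ts) ∣
    ≤⟨ ∣sumℤ∣≤sum∣∣ (map E ts) ⟩
  sum (map ℤ.∣_∣ (map E ts))
    ≡⟨ cong sum (map-∘ ts) ⟨
  sum (map (ℤ.∣_∣ ∘ E) ts)
    ≡⟨ sum-map-cong ts (λ t → trans (if-float ℤ.∣_∣ (sumV t ≡ᵇ i))
         (cong (λ w → if sumV t ≡ᵇ i then w else 0) (∣tupleTerm∣≡tupleWeight k n α t))) ⟩
  σ⁺ k n (ℤ.∣_∣ ∘ α) i ∎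
  where
  open ≤-Reasoning
  ts = tuples k n
  E : Vec ℕ k → ℤ
  E t = if sumV t ≡ᵇ i then tupleTerm k n α t else ℤ.0ℤ

∑∣σ∣*^≤∏[∣α∣+a]^n : ∀ k n (α : Fin k → ℤ) a m →
  ∑< m (λ i → ℤ.∣ σ k n α i ∣ * a ^ i) ≤ product (map (λ j → (ℤ.∣ α j ∣ + a) ^ n) (allFin k))
∑∣σ∣*^≤∏[∣α∣+a]^n k n α a m =
  ≤-trans (∑<-mono m (λ i _ → *-monoˡ-≤ (a ^ i) (∣σ∣≤σ⁺ k n α i)))
          (∑σ⁺*^≤∏[x+a]^n k n (ℤ.∣_∣ ∘ α) a m)

ι : ℕ → ℚ
ι b = ℤ.+ b ℚ./ 1

toℚᵘ-/ : ∀ x d → toℚᵘ (x ℚ./ suc d) ℚᵘ.≃ mkℚᵘ x d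
toℚᵘ-/ x d = ℚₚ.toℚᵘ-fromℚᵘ (mkℚᵘ x d)

mkℚᵘ-mono-≤ : ∀ a b d e → a * suc e ≤ b * suc d → mkℚᵘ (ℤ.+ a) d ℚᵘ.≤ mkℚᵘ (ℤ.+ b) e
mkℚᵘ-mono-≤ a b d e h = *≤* (subst₂ ℤ._≤_ (ℤₚ.pos-* a (suc e)) (ℤₚ.pos-* b (suc d)) (ℤ.+≤+ h))

∣/∣≤ι : ∀ x d B .{{_ : NonZero d}} → ℤ.∣ x ∣ ≤ B * d → ℚ.∣ x ℚ./ d ∣ ℚ.≤ ι B
∣/∣≤ι x (suc d) B h = ℚₚ.toℚᵘ-cancel-≤ (begin
  toℚᵘ ℚ.∣ x ℚ./ suc d ∣        ≃⟨ ℚₚ.toℚᵘ-homo-∣-∣ (x ℚ./ suc d) ⟩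
  ℚᵘ.∣ toℚᵘ (x ℚ./ suc d) ∣      ≃⟨ ℚᵘₚ.∣-∣-cong (toℚᵘ-/ x d) ⟩
  mkℚᵘ (ℤ.+ ℤ.∣ x ∣) d           ≤⟨ mkℚᵘ-mono-≤ ℤ.∣ x ∣ B d 0 (≤-trans (≤-reflexive (*-identityʳ _)) h) ⟩
  mkℚᵘ (ℤ.+ B) 0                 ≃⟨ toℚᵘ-/ (ℤ.+ B) 0 ⟨
  toℚᵘ (ι B)                     ∎)
  where open ℚᵘₚ.≤-Reasoning

ι≤/ : ∀ a b d .{{_ : NonZero d}} → a * d ≤ b → ι a ℚ.≤ ℤ.+ b ℚ./ d
ι≤/ a b (suc d) h = ℚₚ.toℚᵘ-cancel-≤ (begin
  toℚᵘ (ι a)                 ≃⟨ toℚᵘ-/ (ℤ.+ a) 0 ⟩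
  mkℚᵘ (ℤ.+ a) 0             ≤⟨ mkℚᵘ-mono-≤ a b 0 d (≤-trans h (≤-reflexive (sym (*-identityʳ b)))) ⟩
  mkℚᵘ (ℤ.+ b) d             ≃⟨ toℚᵘ-/ (ℤ.+ b) d ⟨
  toℚᵘ (ℤ.+ b ℚ./ suc d)     ∎)
  where open ℚᵘₚ.≤-Reasoning

ι-mono-≤ : ∀ {a b} → a ≤ b → ι a ℚ.≤ ι b
ι-mono-≤ {a} {b} a≤b = ι≤/ a b 1 (≤-trans (≤-reflexive (*-identityʳ a)) a≤b)

ι-homo-+ : ∀ a b → ι a ℚ.+ ι b ≡ ι (a + b)
ι-homo-+ a b = ℚₚ.toℚᵘ-injective (begin-equality
  toℚᵘ (ι a ℚ.+ ι b)                 ≃⟨ ℚₚ.toℚᵘ-homo-+ (ι a) (ι b) ⟩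
  toℚᵘ (ι a) ℚᵘ.+ toℚᵘ (ι b)         ≃⟨ ℚᵘₚ.+-cong (toℚᵘ-/ (ℤ.+ a) 0) (toℚᵘ-/ (ℤ.+ b) 0) ⟩
  mkℚᵘ (ℤ.+ a) 0 ℚᵘ.+ mkℚᵘ (ℤ.+ b) 0 ≃⟨ *≡* (cong (ℤ._* ℤ.+ 1) numerators) ⟩
  mkℚᵘ (ℤ.+ (a + b)) 0               ≃⟨ toℚᵘ-/ (ℤ.+ (a + b)) 0 ⟨
  toℚᵘ (ι (a + b))                   ∎)
  where
  open ℚᵘₚ.≤-Reasoning
  numerators : ℤ.+ a ℤ.* ℤ.+ 1 ℤ.+ ℤ.+ b ℤ.* ℤ.+ 1 ≡ ℤ.+ (a + b)
  numerators =
    trans (cong₂ ℤ._+_ (ℤₚ.*-identityʳ (ℤ.+ a)) (ℤₚ.*-identityʳ (ℤ.+ b))) (sym (ℤₚ.pos-+ a b))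

ι-homo-* : ∀ a b → ι a ℚ.* ι b ≡ ι (a * b)
ι-homo-* a b = ℚₚ.toℚᵘ-injective (begin-equality
  toℚᵘ (ι a ℚ.* ι b)                 ≃⟨ ℚₚ.toℚᵘ-homo-* (ι a) (ι b) ⟩
  toℚᵘ (ι a) ℚᵘ.* toℚᵘ (ι b)         ≃⟨ ℚᵘₚ.*-cong (toℚᵘ-/ (ℤ.+ a) 0) (toℚᵘ-/ (ℤ.+ b) 0) ⟩
  mkℚᵘ (ℤ.+ a) 0 ℚᵘ.* mkℚᵘ (ℤ.+ b) 0 ≃⟨ *≡* (cong (ℤ._* ℤ.+ 1) (sym (ℤₚ.pos-* a b))) ⟩
  mkℚᵘ (ℤ.+ (a * b)) 0               ≃⟨ toℚᵘ-/ (ℤ.+ (a * b)) 0 ⟨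
  toℚᵘ (ι (a * b))                   ∎)
  where open ℚᵘₚ.≤-Reasoning

∣ι*∣≤ι* : ∀ c {q X} → ℚ.∣ q ∣ ℚ.≤ ι X → ℚ.∣ ι c ℚ.* q ∣ ℚ.≤ ι (c * X)
∣ι*∣≤ι* c {q} {X} ∣q∣≤X = begin
  ℚ.∣ ι c ℚ.* q ∣        ≡⟨ ℚₚ.∣p*q∣≡∣p∣*∣q∣ (ι c) q ⟩
  ℚ.∣ ι c ∣ ℚ.* ℚ.∣ q ∣  ≡⟨ cong (ℚ._* ℚ.∣ q ∣) (ℚₚ.0≤p⇒∣p∣≡p (ι-mono-≤ {0} {c} z≤n)) ⟩
  ι c ℚ.* ℚ.∣ q ∣        ≤⟨ ℚₚ.*-monoˡ-≤-nonNeg (ι c) {{ℚₚ.normalize-nonNeg c 1}} ∣q∣≤X ⟩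
  ι c ℚ.* ι X            ≡⟨ ι-homo-* c X ⟩
  ι (c * X)              ∎
  where open ℚₚ.≤-Reasoning

∣sumℚ∣≤ι∑< : ∀ n (f : ℕ → ℚ) (b : ℕ → ℕ) → (∀ i → i < n → ℚ.∣ f i ∣ ℚ.≤ ι (b i)) →
             ℚ.∣ sumℚ (map f (upTo n)) ∣ ℚ.≤ ι (∑< n b)
∣sumℚ∣≤ι∑< n f b ∣f∣≤b rewrite map-upTo f n = ∣sumℚ-applyUpTo∣≤ n f b ∣f∣≤b
  where
  ∣sumℚ-applyUpTo∣≤ : ∀ n (f : ℕ → ℚ) (b : ℕ → ℕ) → (∀ i → i < n → ℚ.∣ f i ∣ ℚ.≤ ι (b i)) →
                      ℚ.∣ sumℚ (applyUpTo f n) ∣ ℚ.≤ ι (∑< n b)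
  ∣sumℚ-applyUpTo∣≤ zero    f b _     = ℚₚ.≤-refl
  ∣sumℚ-applyUpTo∣≤ (suc n) f b ∣f∣≤b = begin
    ℚ.∣ f 0 ℚ.+ sumℚ (applyUpTo (f ∘ suc) n) ∣          ≤⟨ ℚₚ.∣p+q∣≤∣p∣+∣q∣ (f 0) _ ⟩
    ℚ.∣ f 0 ∣ ℚ.+ ℚ.∣ sumℚ (applyUpTo (f ∘ suc) n) ∣    ≤⟨ ℚₚ.+-mono-≤ (∣f∣≤b 0 z<s) ∣tail∣≤ ⟩
    ι (b 0) ℚ.+ ι (∑< n (b ∘ suc))                      ≡⟨ ι-homo-+ (b 0) _ ⟩
    ι (∑< (suc n) b)                                     ∎
    where
    open ℚₚ.≤-Reasoning
    ∣tail∣≤ = ∣sumℚ-applyUpTo∣≤ n (f ∘ suc) (b ∘ suc) (λ i i<n → ∣f∣≤b (suc i) (s<s i<n))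

-- The archimedean bounds

!-mono-≤ : ∀ {m n} → m ≤ n → m ! ≤ n !
!-mono-≤ {n = n} m≤n = ∣⇒≤ {{n !≢0}} (m≤n⇒m!∣n! m≤n)

m!*[m+μ]Cμ*μ!≡[m+μ]! : ∀ m μ → m ! * ((m + μ) C μ) * μ ! ≡ (m + μ) !
m!*[m+μ]Cμ*μ!≡[m+μ]! m μ = begin
  m ! * ((m + μ) C μ) * μ !                ≡⟨ rearrange (m !) ((m + μ) C μ) (μ !) ⟩
  ((m + μ) C μ) * (μ ! * m !)              ≡⟨ cong (λ r → ((m + μ) C μ) * (μ ! * r !)) (m+n∸n≡m m μ) ⟨
  ((m + μ) C μ) * (μ ! * (m + μ ∸ μ) !)    ≡⟨ cong (_* (μ ! * (m + μ ∸ μ) !)) (nCk≡n!/k![n-k]! μ≤m+μ) ⟩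
  (m + μ) ! / (μ ! * (m + μ ∸ μ) !) * (μ ! * (m + μ ∸ μ) !)
                                           ≡⟨ m/n*n≡m (k![n∸k]!∣n! μ≤m+μ) ⟩
  (m + μ) !                                ∎
  where
  open ≡-Reasoning
  instance _ = μ !* (m + μ ∸ μ) !≢0
  μ≤m+μ = m≤n+m μ m
  rearrange : ∀ x y z → x * y * z ≡ y * (z * x)
  rearrange = solve-∀

[m+μ]!≤m!*[m+μ]Cμ*[i+μ]! : ∀ m μ i → (m + μ) ! ≤ m ! * ((m + μ) C μ) * (i + μ) !
[m+μ]!≤m!*[m+μ]Cμ*[i+μ]! m μ i = begin
  (m + μ) !                              ≡⟨ m!*[m+μ]Cμ*μ!≡[m+μ]! m μ ⟨
  m ! * ((m + μ) C μ) * μ !              ≤⟨ *-monoʳ-≤ (m ! * ((m + μ) C μ)) (!-mono-≤ (m≤n+m μ i)) ⟩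
  m ! * ((m + μ) C μ) * (i + μ) !        ∎
  where open ≤-Reasoning

B0-bound : ∀ k n μ (α : Fin k → ℤ) →
  ℚ.∣ B0 k n μ α ∣ ℚ.≤
  ℤ.+ ((k * n) ! * ((k * n + μ) C μ) * product (map (λ i → (ℤ.∣ α i ∣ + 1) ^ n) (allFin k))) ℚ./ 1
B0-bound k n μ α =
  ℚₚ.≤-trans (∣sumℚ∣≤ι∑< (suc kn) _ (λ i → ∣σ∣ i * G) term-bound) (ι-mono-≤ (begin
  ∑< (suc kn) (λ i → ∣σ∣ i * G)        ≡⟨ ∑<-distribʳ (suc kn) ∣σ∣ G ⟨
  ∑< (suc kn) ∣σ∣ * G                  ≡⟨ cong (_* G) (∑<-cong (suc kn) ∣σ∣≡∣σ∣*1^) ⟩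
  ∑< (suc kn) (λ i → ∣σ∣ i * 1 ^ i) * G ≤⟨ *-monoˡ-≤ G (∑∣σ∣*^≤∏[∣α∣+a]^n k n α 1 (suc kn)) ⟩
  Π * G                                ≡⟨ *-comm Π G ⟩
  G * Π                                ∎))
  where
  open ≤-Reasoning
  kn = k * n
  G = kn ! * ((kn + μ) C μ)
  Π = product (map (λ i → (ℤ.∣ α i ∣ + 1) ^ n) (allFin k))
  ∣σ∣ : ℕ → ℕ
  ∣σ∣ i = ℤ.∣ σ k n α i ∣
  ∣σ∣≡∣σ∣*1^ : ∀ i → ∣σ∣ i ≡ ∣σ∣ i * 1 ^ i
  ∣σ∣≡∣σ∣*1^ i = sym (trans (cong (∣σ∣ i *_) (^-zeroˡ i)) (*-identityʳ (∣σ∣ i)))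
  term-bound : ∀ i → i < suc kn →
    ℚ.∣ ℚ._/_ (σ k n α i ℤ.* ℤ.+ ((kn + μ) !)) ((i + μ) !) {{(i + μ) !≢0}} ∣ ℚ.≤ ι (∣σ∣ i * G)
  term-bound i _ =
    ∣/∣≤ι (σ k n α i ℤ.* ℤ.+ ((kn + μ) !)) ((i + μ) !) (∣σ∣ i * G) {{(i + μ) !≢0}} (begin
    ℤ.∣ σ k n α i ℤ.* ℤ.+ ((kn + μ) !) ∣   ≡⟨ ℤₚ.abs-* (σ k n α i) _ ⟩
    ∣σ∣ i * (kn + μ) !                      ≤⟨ *-monoʳ-≤ (∣σ∣ i) ([m+μ]!≤m!*[m+μ]Cμ*[i+μ]! kn μ i) ⟩
    ∣σ∣ i * (G * (i + μ) !)                 ≡⟨ *-assoc (∣σ∣ i) G _ ⟨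
    ∣σ∣ i * G * (i + μ) !                   ∎)

1+N∸h≤m∸h+μ : ∀ {N h m μ} → h ≤ N → h ≤ m → N < m + μ → suc (N ∸ h) ≤ m ∸ h + μ
1+N∸h≤m∸h+μ {N} {h} {m} {μ} h≤N h≤m N<m+μ = begin
  suc (N ∸ h)   ≡⟨ +-∸-assoc 1 h≤N ⟨
  suc N ∸ h     ≤⟨ ∸-monoˡ-≤ h N<m+μ ⟩
  m + μ ∸ h     ≡⟨ +-∸-comm μ h≤m ⟩
  m ∸ h + μ     ∎
  where open ≤-Reasoning

shifted-sum-bound : ∀ (s : ℕ → ℕ) m μ a .{{_ : NonZero a}} N → N < m + μ →
  ∑< (suc (m ⊓ N)) (λ h → s (m ∸ h) * a ^ (N ∸ h)) * a ≤ ∑< (suc m) (λ i → s i * a ^ i) * a ^ μ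
shifted-sum-bound s m μ a N N<m+μ = begin
  ∑< (suc (m ⊓ N)) (λ h → s (m ∸ h) * a ^ (N ∸ h)) * a
    ≡⟨ ∑<-distribʳ (suc (m ⊓ N)) (λ h → s (m ∸ h) * a ^ (N ∸ h)) a ⟩
  ∑< (suc (m ⊓ N)) (λ h → s (m ∸ h) * a ^ (N ∸ h) * a)
    ≤⟨ ∑<-mono (suc (m ⊓ N)) (λ h h≤m⊓N → term-bound h (s≤s⁻¹ h≤m⊓N)) ⟩
  ∑< (suc (m ⊓ N)) (λ h → g (m ∸ h))
    ≤⟨ ∑<-monoˡ (λ h → g (m ∸ h)) (s≤s (m⊓n≤m m N)) ⟩
  ∑< (suc m) (λ h → g (m ∸ h))
    ≡⟨ ∑<-reverse m g ⟩
  ∑< (suc m) g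
    ≡⟨ ∑<-distribʳ (suc m) (λ i → s i * a ^ i) (a ^ μ) ⟨
  ∑< (suc m) (λ i → s i * a ^ i) * a ^ μ ∎
  where
  open ≤-Reasoning
  g : ℕ → ℕ
  g i = s i * a ^ i * a ^ μ
  term-bound : ∀ h → h ≤ m ⊓ N → s (m ∸ h) * a ^ (N ∸ h) * a ≤ g (m ∸ h)
  term-bound h h≤m⊓N = begin
    s (m ∸ h) * a ^ (N ∸ h) * a         ≡⟨ *-assoc (s (m ∸ h)) _ a ⟩
    s (m ∸ h) * (a ^ (N ∸ h) * a)       ≡⟨ cong (s (m ∸ h) *_) (*-comm (a ^ (N ∸ h)) a) ⟩
    s (m ∸ h) * a ^ suc (N ∸ h)         ≤⟨ *-monoʳ-≤ (s (m ∸ h)) (^-monoʳ-≤ a exponent-bound) ⟩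
    s (m ∸ h) * a ^ (m ∸ h + μ)         ≡⟨ cong (s (m ∸ h) *_) (^-distribˡ-+-* a (m ∸ h) μ) ⟩
    s (m ∸ h) * (a ^ (m ∸ h) * a ^ μ)   ≡⟨ *-assoc (s (m ∸ h)) _ _ ⟨
    g (m ∸ h)                           ∎
    where
    exponent-bound = 1+N∸h≤m∸h+μ (≤-trans h≤m⊓N (m⊓n≤n m N)) (≤-trans h≤m⊓N (m⊓n≤m m N)) N<m+μ

double-sum-bound : ∀ (s : ℕ → ℕ) m μ a .{{_ : NonZero a}} →
  ∑< (m + μ) (λ N → ∑< (suc (m ⊓ N)) (λ h → s (m ∸ h) * a ^ (N ∸ h))) * a
    ≤ (m + μ) * (∑< (suc m) (λ i → s i * a ^ i) * a ^ μ)
double-sum-bound s m μ a = begin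
  ∑< (m + μ) I * a                                        ≡⟨ ∑<-distribʳ (m + μ) I a ⟩
  ∑< (m + μ) (λ N → I N * a)                              ≤⟨ ∑<-mono (m + μ) (shifted-sum-bound s m μ a) ⟩
  ∑< (m + μ) (λ _ → ∑< (suc m) (λ i → s i * a ^ i) * a ^ μ) ≡⟨ ∑<-const (m + μ) _ ⟩
  (m + μ) * (∑< (suc m) (λ i → s i * a ^ i) * a ^ μ)        ∎
  where
  open ≤-Reasoning
  I : ℕ → ℕ
  I N = ∑< (suc (m ⊓ N)) (λ h → s (m ∸ h) * a ^ (N ∸ h))

Bj-majorant : (k n μ : ℕ) (α : Fin k → ℤ) (j : Fin k) → ℕ
Bj-majorant k n μ α j =
  ∑< (k * n + μ) (λ N → ∑< (suc (k * n ⊓ N)) (λ h → ℤ.∣ σ k n α (k * n ∸ h) ∣ * ℤ.∣ α j ∣ ^ (N ∸ h)))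

∣Bj∣≤ι[majorant] : ∀ k n μ (α : Fin k → ℤ) j →
                   ℚ.∣ Bj k n μ α j ∣ ℚ.≤ ι ((k * n + μ) ! * Bj-majorant k n μ α j)
∣Bj∣≤ι[majorant] k n μ α j = ∣ι*∣≤ι* (W !) (∣sumℚ∣≤ι∑< W inner _ (λ N N<W →
  ∣sumℚ∣≤ι∑< (suc (kn ⊓ N)) (term N) (λ h → ∣σ∣ (kn ∸ h) * a ^ (N ∸ h)) (∣term∣≤ N N<W)))
  where
  open ≤-Reasoning
  kn = k * n
  W = kn + μ
  a = ℤ.∣ α j ∣
  ∣σ∣ : ℕ → ℕ
  ∣σ∣ i = ℤ.∣ σ k n α i ∣
  numerator : ℕ → ℕ → ℤ
  numerator N h = σ k n α (kn ∸ h) ℤ.* ℤ.+ ((N ∸ h) !) ℤ.* α j ℤ.^ (N ∸ h)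
  term : ℕ → ℕ → ℚ
  term N h = ℚ._/_ (numerator N h) ((W ∸ h) !) {{(W ∸ h) !≢0}}
  inner : ℕ → ℚ
  inner N = sumℚ (map (term N) (upTo (suc (kn ⊓ N))))
  ∣term∣≤ : ∀ N → N < W → ∀ h → h < suc (kn ⊓ N) → ℚ.∣ term N h ∣ ℚ.≤ ι (∣σ∣ (kn ∸ h) * a ^ (N ∸ h))
  ∣term∣≤ N N<W h _ =
    ∣/∣≤ι (numerator N h) ((W ∸ h) !) (∣σ∣ (kn ∸ h) * a ^ (N ∸ h)) {{(W ∸ h) !≢0}} (begin
    ℤ.∣ numerator N h ∣
      ≡⟨ trans (ℤₚ.abs-* (σ k n α (kn ∸ h) ℤ.* ℤ.+ ((N ∸ h) !)) _)
               (cong₂ _*_ (ℤₚ.abs-* (σ k n α (kn ∸ h)) _) (∣^∣ (α j) (N ∸ h))) ⟩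
    ∣σ∣ (kn ∸ h) * (N ∸ h) ! * a ^ (N ∸ h)
      ≤⟨ *-monoˡ-≤ (a ^ (N ∸ h)) (*-monoʳ-≤ (∣σ∣ (kn ∸ h)) (!-mono-≤ (∸-monoˡ-≤ h (<⇒≤ N<W)))) ⟩
    ∣σ∣ (kn ∸ h) * (W ∸ h) ! * a ^ (N ∸ h)
      ≡⟨ *-right-comm (∣σ∣ (kn ∸ h)) _ _ ⟩
    ∣σ∣ (kn ∸ h) * a ^ (N ∸ h) * (W ∸ h) ! ∎)

Bj-bound : ∀ k n μ (α : Fin k → ℤ) (j : Fin k) (α≢0 : ℤ.NonZero (α j)) →
  ℚ.∣ Bj k n μ α j ∣ ℚ.≤
  ℚ._/_ (ℤ.+ ((k * n + μ) ! * (k * n + μ) * (ℤ.∣ α j ∣ ^ μ)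
              * product (map (λ i → (ℤ.∣ α i ∣ + ℤ.∣ α j ∣) ^ n) (allFin k))))
        ℤ.∣ α j ∣ {{α≢0}}
Bj-bound k n μ α j α≢0 = ℚₚ.≤-trans (∣Bj∣≤ι[majorant] k n μ α j) (ι≤/ (W ! * X) _ a (begin
  W ! * X * a                                 ≡⟨ *-assoc (W !) X a ⟩
  W ! * (X * a)                               ≤⟨ *-monoʳ-≤ (W !) (double-sum-bound ∣σ∣ kn μ a) ⟩
  W ! * (W * (∑< (suc kn) (λ i → ∣σ∣ i * a ^ i) * a ^ μ))
                                              ≤⟨ *-monoʳ-≤ (W !) (*-monoʳ-≤ W (*-monoˡ-≤ (a ^ μ) ∑∣σ∣a^i≤Π)) ⟩
  W ! * (W * (Π * a ^ μ))                     ≡⟨ rearrange (W !) W Π (a ^ μ) ⟩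
  W ! * W * a ^ μ * Π                         ∎))
  where
  open ≤-Reasoning
  instance _ = α≢0
  kn = k * n
  W = kn + μ
  a = ℤ.∣ α j ∣
  X = Bj-majorant k n μ α j
  Π = product (map (λ i → (ℤ.∣ α i ∣ + a) ^ n) (allFin k))
  ∣σ∣ : ℕ → ℕ
  ∣σ∣ i = ℤ.∣ σ k n α i ∣
  ∑∣σ∣a^i≤Π = ∑∣σ∣*^≤∏[∣α∣+a]^n k n α a (suc kn)
  rearrange : ∀ f w p q → f * (w * (p * q)) ≡ f * w * q * p
  rearrange = solve-∀

-- The p-adic bound

^-distribʳ-* : ∀ a b e → (a * b) ^ e ≡ a ^ e * b ^ e
^-distribʳ-* a b zero    = refl
^-distribʳ-* a b (suc e) =
  trans (cong (a * b *_) (^-distribʳ-* a b e)) (*-interchange a b (a ^ e) (b ^ e))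

^-monoʳ-∣ : ∀ a {d e} → d ≤ e → a ^ d ∣ a ^ e
^-monoʳ-∣ a {d} {e} d≤e = divides (a ^ (e ∸ d)) (begin
  a ^ e               ≡⟨ cong (a ^_) (m∸n+n≡m d≤e) ⟨
  a ^ (e ∸ d + d)     ≡⟨ ^-distribˡ-+-* a (e ∸ d) d ⟩
  a ^ (e ∸ d) * a ^ d ∎)
  where open ≡-Reasoning

prime-power-split : ∀ {p} → Prime p → ∀ x → .{{NonZero x}} → ∃[ v ] ∃[ u ] x ≡ p ^ v * u × p ∤ u
prime-power-split {p} p-prime = <-rec Split split
  where
  instance
    _ = prime⇒nonZero p-prime
    _ = prime⇒nonTrivial p-prime
  Split : ℕ → Set
  Split x = .{{NonZero x}} → ∃[ v ] ∃[ u ] x ≡ p ^ v * u × p ∤ u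
  split : ∀ x → (∀ {y} → y < x → Split y) → Split x
  split x rec with p ∣? x
  ... | no  p∤x = 0 , x , sym (+-identityʳ x) , p∤x
  ... | yes p∣x@(divides q x≡q*p) with rec (quotient-< p∣x) {{quotient≢0 p∣x}}
  ...   | v , u , q≡p^v*u , p∤u = suc v , u , x≡p^[1+v]*u , p∤u
    where
    open ≡-Reasoning
    x≡p^[1+v]*u : x ≡ p ^ suc v * u
    x≡p^[1+v]*u = begin
      x                 ≡⟨ x≡q*p ⟩
      q * p             ≡⟨ cong (_* p) q≡p^v*u ⟩
      p ^ v * u * p     ≡⟨ *-right-comm (p ^ v) u p ⟩
      p ^ v * p * u     ≡⟨ cong (_* u) (*-comm (p ^ v) p) ⟩
      p ^ suc v * u     ∎

argmin : ∀ {k} (v : Fin (suc k) → ℕ) → ∃[ i₀ ] ∀ i → v i₀ ≤ v i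
argmin {zero}  v = Fin.zero , λ { Fin.zero → ≤-refl }
argmin {suc k} v with argmin (v ∘ Fin.suc)
... | i₁ , min₁ with v Fin.zero ≤? v (Fin.suc i₁)
...   | yes v₀≤v₁ = Fin.zero   , λ { Fin.zero → ≤-refl ; (Fin.suc i) → ≤-trans v₀≤v₁ (min₁ i) }
...   | no  v₀≰v₁ = Fin.suc i₁ , λ { Fin.zero → <⇒≤ (≰⇒> v₀≰v₁) ; (Fin.suc i) → min₁ i }

∤⇒∤^ : ∀ {p u} → Prime p → p ∤ u → ∀ D → p ∤ u ^ D
∤⇒∤^ {p} p-prime p∤u zero    p∣1 = nonTrivial⇒≢1 {{prime⇒nonTrivial p-prime}} (∣1⇒≡1 p∣1)
∤⇒∤^ {p} p-prime p∤u (suc D) p∣u^[1+D] with euclidsLemma _ _ p-prime p∣u^[1+D]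
... | inj₁ p∣u   = p∤u p∣u
... | inj₂ p∣u^D = ∤⇒∤^ p-prime p∤u D p∣u^D

p^e∣y*w⇒p^e∣y : ∀ {p w} → Prime p → p ∤ w → ∀ e y → p ^ e ∣ y * w → p ^ e ∣ y
p^e∣y*w⇒p^e∣y         p-prime p∤w zero    y _ = 1∣ y
p^e∣y*w⇒p^e∣y {p} {w} p-prime p∤w (suc e) y p^[1+e]∣yw
  with euclidsLemma y w p-prime (m*n∣⇒m∣ p (p ^ e) p^[1+e]∣yw)
... | inj₂ p∣w = contradiction p∣w p∤w
... | inj₁ (divides q y≡q*p) =
  subst (p ^ suc e ∣_) (trans (*-comm p q) (sym y≡q*p))
        (*-monoʳ-∣ p (p^e∣y*w⇒p^e∣y p-prime p∤w e q p^e∣qw))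
  where
  instance _ = prime⇒nonZero p-prime
  p^e∣qw : p ^ e ∣ q * w
  p^e∣qw = *-cancelˡ-∣ p (subst (p ^ suc e ∣_) (begin
    y * w         ≡⟨ cong (_* w) y≡q*p ⟩
    q * p * w     ≡⟨ *-right-comm q p w ⟩
    q * w * p     ≡⟨ *-comm (q * w) p ⟩
    p * (q * w)   ∎) p^[1+e]∣yw)
    where open ≡-Reasoning

common-prime-power-divisor : ∀ {p k} → Prime p → (x : Fin (suc k) → ℕ) → (∀ i → NonZero (x i)) →
  ∀ c D e → (∀ i → p ^ e ∣ c * x i ^ D) → ∃[ m ] (∀ i → p ^ m ∣ x i) × p ^ e ∣ c * (p ^ m) ^ D
common-prime-power-divisor {p} p-prime x x≢0 c D e p^e∣cx^D = m , p^m∣x , p^e∣c*p^mD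
  where
  split : ∀ i → ∃[ v ] ∃[ u ] x i ≡ p ^ v * u × p ∤ u
  split i = prime-power-split p-prime (x i) {{x≢0 i}}
  v u : Fin _ → ℕ
  v i = proj₁ (split i)
  u i = proj₁ (proj₂ (split i))
  x≡p^v*u : ∀ i → x i ≡ p ^ v i * u i
  x≡p^v*u i = proj₁ (proj₂ (proj₂ (split i)))
  p∤u : ∀ i → p ∤ u i
  p∤u i = proj₂ (proj₂ (proj₂ (split i)))
  i₀ = proj₁ (argmin v)
  m = v i₀
  p^m∣x : ∀ i → p ^ m ∣ x i
  p^m∣x i = subst (p ^ m ∣_) (sym (x≡p^v*u i)) (∣m⇒∣m*n (u i) (^-monoʳ-∣ p (proj₂ (argmin v) i)))
  p^e∣c*p^mD : p ^ e ∣ c * (p ^ m) ^ D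
  p^e∣c*p^mD = p^e∣y*w⇒p^e∣y p-prime (∤⇒∤^ p-prime (p∤u i₀) D) e (c * (p ^ m) ^ D)
    (subst (p ^ e ∣_) (begin
      c * x i₀ ^ D                    ≡⟨ cong (λ z → c * z ^ D) (x≡p^v*u i₀) ⟩
      c * (p ^ m * u i₀) ^ D          ≡⟨ cong (c *_) (^-distribʳ-* (p ^ m) (u i₀) D) ⟩
      c * ((p ^ m) ^ D * u i₀ ^ D)    ≡⟨ *-assoc c _ _ ⟨
      c * (p ^ m) ^ D * u i₀ ^ D      ∎) (p^e∣cx^D i₀))
    where open ≡-Reasoning

*-pres-∣ₛ : ∀ {a b x y} → a ∣ₛ x → b ∣ₛ y → a ℤ.* b ∣ₛ x ℤ.* y
*-pres-∣ₛ {a} {y = y} a∣x b∣y = ℤ∣.∣-trans (ℤ∣.*-monoʳ-∣ a b∣y) (ℤ∣.*-monoˡ-∣ y a∣x)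

^-pres-∣ₛ : ∀ {a x} e → a ∣ₛ x → a ℤ.^ e ∣ₛ x ℤ.^ e
^-pres-∣ₛ zero    a∣x = ℤ∣.∣-refl
^-pres-∣ₛ (suc e) a∣x = *-pres-∣ₛ a∣x (^-pres-∣ₛ e a∣x)

^-monoʳ-∣ₛ : ∀ a {d e} → d ≤ e → a ℤ.^ d ∣ₛ a ℤ.^ e
^-monoʳ-∣ₛ a {d} {e} d≤e =
  ℤ∣.∣ᵤ⇒∣ (subst₂ _∣_ (sym (∣^∣ a d)) (sym (∣^∣ a e)) (^-monoʳ-∣ ℤ.∣ a ∣ d≤e))

_∣ₛ0 : ∀ a → a ∣ₛ ℤ.0ℤ
a ∣ₛ0 = divides ℤ.0ℤ (sym (ℤₚ.*-zeroˡ a))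

∣ₛ-sumℤ : ∀ {A : Set} {a} (f : A → ℤ) xs → (∀ x → a ∣ₛ f x) → a ∣ₛ sumℤ (map f xs)
∣ₛ-sumℤ {a = a} f []       a∣f = a ∣ₛ0
∣ₛ-sumℤ         f (x ∷ xs) a∣f = ℤ∣.∣m∣n⇒∣m+n (a∣f x) (∣ₛ-sumℤ f xs a∣f)

^sum-∣ₛ-prodℤ : ∀ {A : Set} a (e : A → ℕ) (f : A → ℤ) xs → (∀ x → a ℤ.^ e x ∣ₛ f x) →
                a ℤ.^ sum (map e xs) ∣ₛ prodℤ (map f xs)
^sum-∣ₛ-prodℤ a e f []       _    = ℤ∣.∣-refl
^sum-∣ₛ-prodℤ a e f (x ∷ xs) a^e∣f = subst (_∣ₛ prodℤ (map f (x ∷ xs)))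
  (sym (ℤₚ.^-distribˡ-+-* a (e x) _)) (*-pres-∣ₛ (a^e∣f x) (^sum-∣ₛ-prodℤ a e f xs a^e∣f))

a+b∸[c+d]≤[a∸c]+[b∸d] : ∀ a b c d → a + b ∸ (c + d) ≤ (a ∸ c) + (b ∸ d)
a+b∸[c+d]≤[a∸c]+[b∸d] a b c d = m≤n+o⇒m∸n≤o (a + b) (c + d) (begin
  a + b                               ≤⟨ +-mono-≤ (m≤n+m∸n a c) (m≤n+m∸n b d) ⟩
  (c + (a ∸ c)) + (d + (b ∸ d))       ≡⟨ +-interchange c (a ∸ c) d (b ∸ d) ⟩
  (c + d) + ((a ∸ c) + (b ∸ d))       ∎)
  where open ≤-Reasoning

k*n∸sumV≤sum[n∸t] : ∀ k n (t : Vec ℕ k) →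
                    k * n ∸ sumV t ≤ sum (map (λ j → n ∸ lookup t j) (allFin k))
k*n∸sumV≤sum[n∸t] zero    n []      = z≤n
k*n∸sumV≤sum[n∸t] (suc k) n (c ∷ t) = begin
  n + k * n ∸ (c + sumV t)     ≤⟨ a+b∸[c+d]≤[a∸c]+[b∸d] n (k * n) c (sumV t) ⟩
  (n ∸ c) + (k * n ∸ sumV t)   ≤⟨ +-monoʳ-≤ (n ∸ c) (k*n∸sumV≤sum[n∸t] k n t) ⟩
  (n ∸ c) + sum (map (λ j → n ∸ lookup t j) (allFin k))
                               ≡⟨ cong sum (map-allFin-suc k (λ j → n ∸ lookup (c ∷ t) j)) ⟨
  sum (map (λ j → n ∸ lookup (c ∷ t) j) (allFin (suc k))) ∎
  where open ≤-Reasoning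

σ-divisible : ∀ k n (α : Fin k → ℤ) P → (∀ j → P ∣ₛ α j) → ∀ i → P ℤ.^ (k * n ∸ i) ∣ₛ σ k n α i
σ-divisible k n α P P∣α i = ℤ∣.∣n⇒∣m*n (-1ℤ ℤ.^ i) (∣ₛ-sumℤ E (tuples k n) P^[kn∸i]∣E)
  where
  E : Vec ℕ k → ℤ
  E t = if sumV t ≡ᵇ i then tupleTerm k n α t else ℤ.0ℤ
  P^[kn∸sumV]∣term : ∀ t → P ℤ.^ (k * n ∸ sumV t) ∣ₛ tupleTerm k n α t
  P^[kn∸sumV]∣term t = ℤ∣.∣-trans (^-monoʳ-∣ₛ P (k*n∸sumV≤sum[n∸t] k n t))
    (^sum-∣ₛ-prodℤ P (λ j → n ∸ lookup t j) (tupleFactor n α t) (allFin k)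
      (λ j → ℤ∣.∣n⇒∣m*n (ℤ.+ (n C lookup t j)) (^-pres-∣ₛ (n ∸ lookup t j) (P∣α j))))
  P^[kn∸i]∣E : ∀ t → P ℤ.^ (k * n ∸ i) ∣ₛ E t
  P^[kn∸i]∣E t with sumV t ≡ᵇ i in eq
  ... | false = (P ℤ.^ (k * n ∸ i)) ∣ₛ0
  ... | true  = subst (λ s → P ℤ.^ (k * n ∸ s) ∣ₛ tupleTerm k n α t)
                      (≡ᵇ⇒≡ (sumV t) i (subst T (sym eq) tt)) (P^[kn∸sumV]∣term t)

Sterm-divisible : ∀ k n μ (α : Fin k → ℤ) j P → (∀ i → P ∣ₛ α i) → ∀ h →
  ℤ.+ ((k * n + μ) ! * n !) ℤ.* P ℤ.^ (suc k * n) ∣ₛ Sterm k n μ α j h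
Sterm-divisible k n μ α j P P∣α h =
  subst (_∣ₛ Sterm k n μ α j h) divisor-regroup
    (*-pres-∣ₛ (*-pres-∣ₛ c∣coefficient P^n∣α^[n+h+μ]) P^kn∣sum)
  where
  c = (k * n + μ) ! * n !
  c∣coefficient : ℤ.+ c ∣ₛ ℤ.+ (c * h ! * ((n + h) C h))
  c∣coefficient = ℤ∣.∣ᵤ⇒∣ (∣m⇒∣m*n ((n + h) C h) (∣m⇒∣m*n (h !) ∣-refl))
  P^n∣α^[n+h+μ] : P ℤ.^ n ∣ₛ α j ℤ.^ (n + h + μ)
  P^n∣α^[n+h+μ] = ℤ∣.∣-trans (^-monoʳ-∣ₛ P (≤-trans (m≤m+n n h) (m≤m+n (n + h) μ)))
                             (^-pres-∣ₛ (n + h + μ) (P∣α j))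
  P^kn∣summand : ∀ i → P ℤ.^ (k * n) ∣ₛ σ k n α i ℤ.* ℤ.+ ((i + μ + n + h) C (i + μ)) ℤ.* α j ℤ.^ i
  P^kn∣summand i = ℤ∣.∣-trans (^-monoʳ-∣ₛ P (≤-trans (m≤n+m∸n (k * n) i) (≤-reflexive (+-comm i _))))
    (subst (_∣ₛ _) (sym (ℤₚ.^-distribˡ-+-* P (k * n ∸ i) i))
      (*-pres-∣ₛ (ℤ∣.∣m⇒∣m*n _ (σ-divisible k n α P P∣α i)) (^-pres-∣ₛ i (P∣α j))))
  P^kn∣sum = ∣ₛ-sumℤ _ (upTo (suc (k * n))) P^kn∣summand
  divisor-regroup : ℤ.+ c ℤ.* P ℤ.^ n ℤ.* P ℤ.^ (k * n) ≡ ℤ.+ c ℤ.* P ℤ.^ (suc k * n)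
  divisor-regroup =
    trans (ℤₚ.*-assoc (ℤ.+ c) _ _) (cong (ℤ.+ c ℤ.*_) (sym (ℤₚ.^-distribˡ-+-* P n (k * n))))

∣+c*x^D∣ : ∀ c x D → ℤ.∣ ℤ.+ c ℤ.* x ℤ.^ D ∣ ≡ c * ℤ.∣ x ∣ ^ D
∣+c*x^D∣ c x D = trans (ℤₚ.abs-* (ℤ.+ c) (x ℤ.^ D)) (cong (c *_) (∣^∣ x D))

Spartial-padicBound : ∀ k (α : Fin (suc k) → ℤ) → (∀ i → ℤ.NonZero (α i)) →
                      ∀ μ n p → Prime p → ∀ j →
  padicBound p (Spartial (suc k) n μ α j) (suc k)
    (λ i → ℤ.+ ((suc k * n + μ) ! * n !) ℤ.* α i ℤ.^ (suc (suc k) * n))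
Spartial-padicBound k α α≢0 μ n p p-prime j e p^e∣y = 0 , λ N _ →
  ℤ∣.∣⇒∣ᵤ (∣ₛ-sumℤ (Sterm (suc k) n μ α j) (upTo N)
    (λ h → ℤ∣.∣-trans p^e∣c*P^D (Sterm-divisible (suc k) n μ α j P P∣α h)))
  where
  c = (suc k * n + μ) ! * n !
  D = suc (suc k) * n
  common = common-prime-power-divisor p-prime (ℤ.∣_∣ ∘ α) α≢0 c D e
             (λ i → subst (p ^ e ∣_) (∣+c*x^D∣ c (α i) D) (p^e∣y i))
  P = ℤ.+ (p ^ proj₁ common)
  P∣α : ∀ i → P ∣ₛ α i
  P∣α i = ℤ∣.∣ᵤ⇒∣ (proj₁ (proj₂ common) i)
  p^e∣c*P^D : ℤ.+ (p ^ e) ∣ₛ ℤ.+ c ℤ.* P ℤ.^ D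
  p^e∣c*P^D = ℤ∣.∣ᵤ⇒∣ (subst (p ^ e ∣_) (sym (∣+c*x^D∣ c P D)) (proj₂ (proj₂ common)))

-- The statement uses ℤ's +_ unqualified, which would make the sections (m +_) above ambiguous.
open import Data.Integer using (+_)
open import Data.Rational using (∣_∣)

lemma4p3 : (k : ℕ) → 1 ℕ.≤ k → (α : Fin k → ℤ) → Injective _≡_ _≡_ α →
    (α≢0 : ∀ i → ℤ.NonZero (α i)) → (μ n : ℕ) → 1 ℕ.≤ n →
    (∣ B0 k n μ α ∣ ℚ.≤
       ℚ._/_ (+ ((k ℕ.* n) ! ℕ.* ((k ℕ.* n ℕ.+ μ) C μ)
                 ℕ.* prodℕ (map (λ i → (ℤ.∣ α i ∣ ℕ.+ 1) ℕ.^ n) (allFin k)))) 1)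
    × (∀ (j : Fin k) → ∣ Bj k n μ α j ∣ ℚ.≤
       ℚ._/_ (+ ((k ℕ.* n ℕ.+ μ) ! ℕ.* (k ℕ.* n ℕ.+ μ) ℕ.* (ℤ.∣ α j ∣ ℕ.^ μ)
                 ℕ.* prodℕ (map (λ i → (ℤ.∣ α i ∣ ℕ.+ ℤ.∣ α j ∣) ℕ.^ n) (allFin k))))
             ℤ.∣ α j ∣ {{α≢0 j}})
    × (∀ (p : ℕ) → Prime p → ∀ (j : Fin k) →
       padicBound p (Spartial k n μ α j) k
         (λ i → (+ ((k ℕ.* n ℕ.+ μ) ! ℕ.* n !)) ℤ.* (α i ℤ.^ ((suc k) ℕ.* n))))
lemma4p3 (suc k) (s≤s z≤n) α _ α≢0 μ n _ =
  B0-bound (suc k) n μ α ,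
  (λ j → Bj-bound (suc k) n μ α j (α≢0 j)) ,
  (λ p p-prime j → Spartial-padicBound k α α≢0 μ n p p-prime j)
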